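{- Let $p$ be an odd prime. Then $$\sum_{k=0}^{\frac{p-1}{2}}(6k+1)\frac{(\frac12)_k(\frac12-\frac{p}{2})_k(\frac12+\frac{p}{2})_k}{(1)_k(1+\frac{p}{4})_k(1-\frac{p}{4})_k}\cdot\frac{1}{4^k}=(-1)^{\frac{p-1}{2}}p.$$
   Context: For $a\in\mathbb{C}$ and $k\in\mathbb{N}$, $(a)_k=a(a+1)\cdots(a+k-1)$ denotes the rising factorial, with $(a)_0=1$. -}

module Defs where

open import Data.Nat as ℕ using (ℕ; zero; suc)
open import Data.Integer as ℤ using (ℤ; +_)
open import Data.Rational using (ℚ; 0ℚ; 1ℚ; _+_; _*_; _÷_; ≢-nonZero)
open import Data.Rational.Properties using (_≟_)
open import Relation.Nullary using (yes; no)

rising : ℚ → ℕ → ℚ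
rising a zero    = 1ℚ
rising a (suc k) = rising a k * (a + (+ k) Data.Rational./ 1)

-- total division; only ever applied to nonzero denominators in the statement
_÷₀_ : ℚ → ℚ → ℚ
p ÷₀ q with q ≟ 0ℚ
... | yes _  = 0ℚ
... | no q≢0 = _÷_ p q {{≢-nonZero q≢0}}

sumTo : ℕ → (ℕ → ℚ) → ℚ
sumTo zero    f = f 0
sumTo (suc n) f = sumTo n f + f (suc n)

pow : ℚ → ℕ → ℚ
pow q zero    = 1ℚ
pow q (suc n) = pow q n * q

-- Write P = p = 2n + 1 and t(P, k) for the summand. Its parameter ½ − P/2 equals −n, so t(P, k) = 0
-- for k > n: the sum is the whole hypergeometric series, and only the oddness of p matters.
-- Creative telescoping in the step P ↦ P + 4 gives
--   P · t(P + 4, k) − (P + 4) · t(P, k) = G(k + 1) − G(k),   G(k) = t(P + 4, k) · R(k),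
--   R(k) = −8k(2k − 1)P(4k + P + 4) / ((2k + P + 1)(2k + P + 3)(6k + 1)),
-- which becomes a polynomial identity once t(P + 4, k + 1) and t(P, k) are expressed through
-- t(P + 4, k) by their rational ratios. Summing over k ≤ n + 2, where G(0) = G(n + 3) = 0, gives
-- P · S(n + 2) = (P + 4) · S(n), and S(n) = (−1)ⁿ(2n + 1) follows by induction from S(0) = 1 and
-- S(1) = −3. Every denominator met on the way is a product of linear factors that are positive,
-- except those built from 1 − P/4, which are nonzero because P is odd.

module Submission where

open import Data.Empty using (⊥-elim)
open import Data.Integer as ℤ using (+_; -[1+_])
import Data.Integer.Properties as ℤ
open import Data.Maybe using (Maybe; just; nothing)
open import Data.Nat as ℕ using (ℕ; zero; suc; _∸_; _<_)
import Data.Nat.Properties as ℕ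
import Data.Nat.Tactic.RingSolver as ℕ-Solver
open import Data.Nat.Divisibility using (_∣_; divides; ∣-refl; ∣m∣n⇒∣m+n)
open import Data.Nat.DivMod using (m*n/n≡m)
open import Data.Nat.Primality using (Prime)
open import Data.Product using (∃; _,_)
open import Data.Sum using (inj₁; inj₂)
open import Data.Rational
  using (ℚ; _/_; _+_; _-_; _*_; -_; 0ℚ; 1ℚ; ½; 1/_; fromℚᵘ; ≢-nonZero)
open import Data.Rational.Properties
  using ( _≟_; +-*-commutativeRing; *-identityˡ; *-identityʳ; *-assoc; *-comm; *-zeroˡ; *-zeroʳ
        ; +-identityˡ; +-identityʳ; +-comm; +-inverseˡ; *-inverseˡ; *-inverseʳ
        ; toℚᵘ-injective; toℚᵘ-fromℚᵘ; toℚᵘ-homo-+; toℚᵘ-homo-*; toℚᵘ-cong; fromℚᵘ-cong)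
open import Data.Rational.Unnormalised as ℚᵘ using (mkℚᵘ; *≡*)
import Data.Rational.Unnormalised.Properties as ℚᵘ
open import Relation.Binary.PropositionalEquality
open import Relation.Nullary using (¬_; yes; no)
import Tactic.RingSolver.Core.AlmostCommutativeRing as ACR
open import Tactic.RingSolver using (solve-∀)

open import Defs

ℚ-ring : ACR.AlmostCommutativeRing _ _
ℚ-ring = ACR.fromCommutativeRing +-*-commutativeRing isZero
  where
  isZero : (x : ℚ) → Maybe (0ℚ ≡ x)
  isZero x with 0ℚ ≟ x
  ... | yes 0≡x = just 0≡x
  ... | no _    = nothing

*-cancelˡ-≢0 : ∀ {x} a b → x ≢ 0ℚ → x * a ≡ x * b → a ≡ b
*-cancelˡ-≢0 {x} a b x≢0 xa≡xb = begin
  a                ≡⟨ sym (*-identityˡ a) ⟩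
  1ℚ * a           ≡⟨ cong (_* a) (*-inverseˡ x) ⟨
  1/ x * x * a     ≡⟨ *-assoc (1/ x) x a ⟩
  1/ x * (x * a)   ≡⟨ cong (1/ x *_) xa≡xb ⟩
  1/ x * (x * b)   ≡⟨ *-assoc (1/ x) x b ⟨
  1/ x * x * b     ≡⟨ cong (_* b) (*-inverseˡ x) ⟩
  1ℚ * b           ≡⟨ *-identityˡ b ⟩
  b                ∎
  where
  open ≡-Reasoning
  instance _ = ≢-nonZero x≢0

*-≢0 : ∀ {x y} → x ≢ 0ℚ → y ≢ 0ℚ → x * y ≢ 0ℚ
*-≢0 {x} {y} x≢0 y≢0 xy≡0 = y≢0 (*-cancelˡ-≢0 y 0ℚ x≢0 (trans xy≡0 (sym (*-zeroʳ x))))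

÷₀-inverse : ∀ x {y} → y ≢ 0ℚ → y * (x ÷₀ y) ≡ x
÷₀-inverse x {y} y≢0 with y ≟ 0ℚ
... | yes y≡0 = ⊥-elim (y≢0 y≡0)
... | no  y≢0 = begin
  y * (x * 1/ y)   ≡⟨ swap y x (1/ y) ⟩
  x * (y * 1/ y)   ≡⟨ cong (x *_) (*-inverseʳ y) ⟩
  x * 1ℚ           ≡⟨ *-identityʳ x ⟩
  x                ∎
  where
  open ≡-Reasoning
  instance _ = ≢-nonZero y≢0
  swap : ∀ a b c → a * (b * c) ≡ b * (a * c)
  swap = solve-∀ ℚ-ring

p-q≡0⇒p≡q : ∀ {p q} → p - q ≡ 0ℚ → p ≡ q
p-q≡0⇒p≡q {p} {q} p-q≡0 = begin
  p             ≡⟨ shift p q ⟩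
  p - q + q     ≡⟨ cong (_+ q) p-q≡0 ⟩
  0ℚ + q        ≡⟨ +-identityˡ q ⟩
  q             ∎
  where
  open ≡-Reasoning
  shift : ∀ p q → p ≡ p - q + q
  shift = solve-∀ ℚ-ring

0÷₀ : ∀ y → 0ℚ ÷₀ y ≡ 0ℚ
0÷₀ y with y ≟ 0ℚ
... | yes _   = refl
... | no  y≢0 = *-zeroˡ (1/ y) where instance _ = ≢-nonZero y≢0

÷₀-cross : ∀ {x y x′ y′} m m′ e e′ → y ≢ 0ℚ → y′ ≢ 0ℚ →
           x * m ≡ x′ * m′ → y′ * e ≡ y * e′ →
           (x ÷₀ y) * (m * e) ≡ (x′ ÷₀ y′) * (m′ * e′)
÷₀-cross {x} {y} {x′} {y′} m m′ e e′ y≢0 y′≢0 xm≡x′m′ y′e≡ye′ =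
  *-cancelˡ-≢0 _ _ (*-≢0 y≢0 y′≢0) (begin
    y * y′ * (x ÷₀ y * (m * e))          ≡⟨ regroup y y′ (x ÷₀ y) m e ⟩
    y * (x ÷₀ y) * m * (y′ * e)          ≡⟨ cong₂ (λ a b → a * m * b) (÷₀-inverse x y≢0) y′e≡ye′ ⟩
    x * m * (y * e′)                     ≡⟨ cong (_* (y * e′)) xm≡x′m′ ⟩
    x′ * m′ * (y * e′)                   ≡⟨ cong (λ a → a * m′ * (y * e′)) (÷₀-inverse x′ y′≢0) ⟨
    y′ * (x′ ÷₀ y′) * m′ * (y * e′)      ≡⟨ regroup y′ y (x′ ÷₀ y′) m′ e′ ⟨
    y′ * y * (x′ ÷₀ y′ * (m′ * e′))      ≡⟨ cong (_* (x′ ÷₀ y′ * (m′ * e′))) (*-comm y′ y) ⟩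
    y * y′ * (x′ ÷₀ y′ * (m′ * e′))      ∎)
  where
  open ≡-Reasoning
  regroup : ∀ a b u c d → a * b * (u * (c * d)) ≡ a * u * c * (b * d)
  regroup = solve-∀ ℚ-ring

-- With u′ = u E / D and v = u E′ / F, the last hypothesis is the conclusion divided by u and
-- cleared of denominators.
telescoping-from-ratios : ∀ {a b u u′ v D E F E′ q₀ q₁ r₀ r₁} →
  D ≢ 0ℚ → F ≢ 0ℚ → q₀ ≢ 0ℚ → q₁ ≢ 0ℚ →
  u′ * D ≡ u * E → v * F ≡ u * E′ →
  (a * F - b * E′) * D * q₀ * q₁ ≡ E * r₁ * F * q₀ - r₀ * F * D * q₁ →
  a * u - b * v ≡ u′ * (r₁ ÷₀ q₁) - u * (r₀ ÷₀ q₀)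
telescoping-from-ratios {a} {b} {u} {u′} {v} {D} {E} {F} {E′} {q₀} {q₁} {r₀} {r₁}
                        D≢0 F≢0 q₀≢0 q₁≢0 u-ratio v-ratio identity =
  *-cancelˡ-≢0 _ _ (*-≢0 (*-≢0 (*-≢0 F≢0 D≢0) q₀≢0) q₁≢0) (begin
    F * D * q₀ * q₁ * (a * u - b * v)
      ≡⟨ expand a b u v F D q₀ q₁ ⟩
    u * (a * F * D * q₀ * q₁) - b * (v * F) * D * q₀ * q₁
      ≡⟨ cong (λ t → u * (a * F * D * q₀ * q₁) - b * t * D * q₀ * q₁) v-ratio ⟩
    u * (a * F * D * q₀ * q₁) - b * (u * E′) * D * q₀ * q₁
      ≡⟨ collect a b u F E′ D q₀ q₁ ⟩
    u * ((a * F - b * E′) * D * q₀ * q₁)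
      ≡⟨ cong (u *_) identity ⟩
    u * (E * r₁ * F * q₀ - r₀ * F * D * q₁)
      ≡⟨ distribute u E r₁ F q₀ r₀ D q₁ ⟩
    u * E * r₁ * F * q₀ - u * r₀ * F * D * q₁
      ≡⟨ cong₂ (λ s t → s * t * F * q₀ - u * r₀ * F * D * q₁) (sym u-ratio) (sym (÷₀-inverse r₁ q₁≢0)) ⟩
    u′ * D * (q₁ * R₁) * F * q₀ - u * r₀ * F * D * q₁
      ≡⟨ cong (λ t → u′ * D * (q₁ * R₁) * F * q₀ - u * t * F * D * q₁) (sym (÷₀-inverse r₀ q₀≢0)) ⟩
    u′ * D * (q₁ * R₁) * F * q₀ - u * (q₀ * R₀) * F * D * q₁
      ≡⟨ factor u′ u D F q₀ q₁ R₀ R₁ ⟩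
    F * D * q₀ * q₁ * (u′ * R₁ - u * R₀) ∎)
  where
  open ≡-Reasoning
  R₀ = r₀ ÷₀ q₀
  R₁ = r₁ ÷₀ q₁
  expand : ∀ a b u v F D q₀ q₁ →
    F * D * q₀ * q₁ * (a * u - b * v) ≡ u * (a * F * D * q₀ * q₁) - b * (v * F) * D * q₀ * q₁
  expand = solve-∀ ℚ-ring
  collect : ∀ a b u F E′ D q₀ q₁ →
    u * (a * F * D * q₀ * q₁) - b * (u * E′) * D * q₀ * q₁ ≡ u * ((a * F - b * E′) * D * q₀ * q₁)
  collect = solve-∀ ℚ-ring
  distribute : ∀ u E r₁ F q₀ r₀ D q₁ →
    u * (E * r₁ * F * q₀ - r₀ * F * D * q₁) ≡ u * E * r₁ * F * q₀ - u * r₀ * F * D * q₁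
  distribute = solve-∀ ℚ-ring
  factor : ∀ u′ u D F q₀ q₁ R₀ R₁ →
    u′ * D * (q₁ * R₁) * F * q₀ - u * (q₀ * R₀) * F * D * q₁ ≡ F * D * q₀ * q₁ * (u′ * R₁ - u * R₀)
  factor = solve-∀ ℚ-ring

sumTo-telescope : ∀ (f G : ℕ → ℚ) m → (∀ k → f k ≡ G (suc k) - G k) → sumTo m f ≡ G (suc m) - G 0
sumTo-telescope f G zero    step = step 0
sumTo-telescope f G (suc m) step =
  trans (cong₂ _+_ (sumTo-telescope f G m step) (step (suc m))) (cancel (G 0) (G (suc m)) (G (suc (suc m))))
  where
  cancel : ∀ a b c → b - a + (c - b) ≡ c - a
  cancel = solve-∀ ℚ-ring

sumTo-linear : ∀ a b (f g : ℕ → ℚ) m →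
  sumTo m (λ k → a * f k - b * g k) ≡ a * sumTo m f - b * sumTo m g
sumTo-linear a b f g zero    = refl
sumTo-linear a b f g (suc m) =
  trans (cong (_+ (a * f (suc m) - b * g (suc m))) (sumTo-linear a b f g m)) (collect a b _ _ _ _)
  where
  collect : ∀ a b F G x y → a * F - b * G + (a * x - b * y) ≡ a * (F + x) - b * (G + y)
  collect = solve-∀ ℚ-ring

ι : ℕ → ℚ
ι n = + n / 1

fromℚᵘ-homo-+ : ∀ p q → fromℚᵘ (p ℚᵘ.+ q) ≡ fromℚᵘ p + fromℚᵘ q
fromℚᵘ-homo-+ p q = toℚᵘ-injective (ℚᵘ.≃-trans (toℚᵘ-fromℚᵘ (p ℚᵘ.+ q)) (ℚᵘ.≃-sym (ℚᵘ.≃-trans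
  (toℚᵘ-homo-+ (fromℚᵘ p) (fromℚᵘ q)) (ℚᵘ.+-cong (toℚᵘ-fromℚᵘ p) (toℚᵘ-fromℚᵘ q)))))

fromℚᵘ-homo-* : ∀ p q → fromℚᵘ (p ℚᵘ.* q) ≡ fromℚᵘ p * fromℚᵘ q
fromℚᵘ-homo-* p q = toℚᵘ-injective (ℚᵘ.≃-trans (toℚᵘ-fromℚᵘ (p ℚᵘ.* q)) (ℚᵘ.≃-sym (ℚᵘ.≃-trans
  (toℚᵘ-homo-* (fromℚᵘ p) (fromℚᵘ q)) (ℚᵘ.*-cong (toℚᵘ-fromℚᵘ p) (toℚᵘ-fromℚᵘ q)))))

ι-+ : ∀ m n → ι (m ℕ.+ n) ≡ ι m + ι n
ι-+ m n = trans (fromℚᵘ-cong {mkℚᵘ (+ (m ℕ.+ n)) 0} {mkℚᵘ (+ m) 0 ℚᵘ.+ mkℚᵘ (+ n) 0} (*≡* eq))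
                (fromℚᵘ-homo-+ (mkℚᵘ (+ m) 0) (mkℚᵘ (+ n) 0))
  where
  eq : + (m ℕ.+ n) ℤ.* + 1 ≡ (+ m ℤ.* + 1 ℤ.+ + n ℤ.* + 1) ℤ.* + 1
  eq rewrite ℤ.*-identityʳ (+ m) | ℤ.*-identityʳ (+ n) | ℤ.*-identityʳ (+ m ℤ.+ + n) = ℤ.pos-+ m n

ι-* : ∀ m n → ι (m ℕ.* n) ≡ ι m * ι n
ι-* m n = trans (fromℚᵘ-cong {mkℚᵘ (+ (m ℕ.* n)) 0} {mkℚᵘ (+ m) 0 ℚᵘ.* mkℚᵘ (+ n) 0} (*≡* eq))
                (fromℚᵘ-homo-* (mkℚᵘ (+ m) 0) (mkℚᵘ (+ n) 0))
  where
  eq : + (m ℕ.* n) ℤ.* + 1 ≡ (+ m ℤ.* + n) ℤ.* + 1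
  eq rewrite ℤ.*-identityʳ (+ m ℤ.* + n) | ℤ.*-identityʳ (+ (m ℕ.* n)) = ℤ.pos-* m n

ι-suc : ∀ m → ι (suc m) ≡ ι m + 1ℚ
ι-suc m = trans (cong ι (ℕ.+-comm 1 m)) (ι-+ m 1)

ι-linear : ∀ a k b → ι (a ℕ.* k ℕ.+ b) ≡ ι a * ι k + ι b
ι-linear a k b = trans (ι-+ (a ℕ.* k) b) (cong (_+ ι b) (ι-* a k))

/-ι : ∀ m d → + m / suc d ≡ ι m * (+ 1 / suc d)
/-ι m d = trans (fromℚᵘ-cong {mkℚᵘ (+ m) d} {mkℚᵘ (+ m) 0 ℚᵘ.* mkℚᵘ (+ 1) d} (*≡* eq))
                (fromℚᵘ-homo-* (mkℚᵘ (+ m) 0) (mkℚᵘ (+ 1) d))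
  where
  eq : + m ℤ.* + suc (d ℕ.+ 0) ≡ (+ m ℤ.* + 1) ℤ.* + suc d
  eq rewrite ℤ.*-identityʳ (+ m) | ℕ.+-identityʳ d = refl

ι-injective : ∀ {m n} → ι m ≡ ι n → m ≡ n
ι-injective {m} {n} ιm≡ιn with ℚᵘ.≃-trans (ℚᵘ.≃-sym (toℚᵘ-fromℚᵘ (mkℚᵘ (+ m) 0)))
                                (ℚᵘ.≃-trans (toℚᵘ-cong ιm≡ιn) (toℚᵘ-fromℚᵘ (mkℚᵘ (+ n) 0)))
... | *≡* eq = ℤ.+-injective (trans (sym (ℤ.*-identityʳ (+ m))) (trans eq (ℤ.*-identityʳ (+ n))))

ι-suc≢0 : ∀ u → ι (suc u) ≢ 0ℚ
ι-suc≢0 u ι[1+u]≡0 = ℕ.1+n≢0 (ι-injective {suc u} {0} ι[1+u]≡0)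

-- Rising factorials

rising-shift : ∀ a k → rising (a + 1ℚ) k * a ≡ rising a k * (a + ι k)
rising-shift a zero    = trans (*-identityˡ a) (sym (trans (*-identityˡ _) (+-identityʳ a)))
rising-shift a (suc k) = begin
  rising (a + 1ℚ) k * (a + 1ℚ + ι k) * a   ≡⟨ swapʳ (rising (a + 1ℚ) k) (a + 1ℚ + ι k) a ⟩
  rising (a + 1ℚ) k * a * (a + 1ℚ + ι k)   ≡⟨ cong₂ _*_ (rising-shift a k) (shift-index a (ι k)) ⟩
  rising a k * (a + ι k) * (a + (ι k + 1ℚ)) ≡⟨ cong (λ t → rising a k * (a + ι k) * (a + t)) (ι-suc k) ⟨
  rising a k * (a + ι k) * (a + ι (suc k)) ∎
  where
  open ≡-Reasoning
  swapʳ : ∀ r s t → r * s * t ≡ r * t * s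
  swapʳ = solve-∀ ℚ-ring
  shift-index : ∀ a K → a + 1ℚ + K ≡ a + (K + 1ℚ)
  shift-index = solve-∀ ℚ-ring

rising-shift₂ : ∀ a k → rising (a + ι 2) k * (a * (a + 1ℚ)) ≡ rising a k * ((a + ι k) * (a + 1ℚ + ι k))
rising-shift₂ a k = begin
  rising (a + ι 2) k * (a * (a + 1ℚ))             ≡⟨ cong (λ b → rising b k * (a * (a + 1ℚ))) (two a) ⟩
  rising (a + 1ℚ + 1ℚ) k * (a * (a + 1ℚ))         ≡⟨ reassoc (rising (a + 1ℚ + 1ℚ) k) a (a + 1ℚ) ⟩
  rising (a + 1ℚ + 1ℚ) k * (a + 1ℚ) * a           ≡⟨ cong (_* a) (rising-shift (a + 1ℚ) k) ⟩
  rising (a + 1ℚ) k * (a + 1ℚ + ι k) * a          ≡⟨ swapʳ (rising (a + 1ℚ) k) (a + 1ℚ + ι k) a ⟩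
  rising (a + 1ℚ) k * a * (a + 1ℚ + ι k)          ≡⟨ cong (_* (a + 1ℚ + ι k)) (rising-shift a k) ⟩
  rising a k * (a + ι k) * (a + 1ℚ + ι k)         ≡⟨ *-assoc (rising a k) (a + ι k) (a + 1ℚ + ι k) ⟩
  rising a k * ((a + ι k) * (a + 1ℚ + ι k))       ∎
  where
  open ≡-Reasoning
  two : ∀ a → a + ι 2 ≡ a + 1ℚ + 1ℚ
  two = solve-∀ ℚ-ring
  reassoc : ∀ r s t → r * (s * t) ≡ r * t * s
  reassoc = solve-∀ ℚ-ring
  swapʳ : ∀ r s t → r * s * t ≡ r * t * s
  swapʳ = solve-∀ ℚ-ring

rising-negative : ∀ m k → m < k → rising (- ι m) k ≡ 0ℚ
rising-negative m (suc k) m<1+k with ℕ.m<1+n⇒m<n∨m≡n m<1+k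
... | inj₁ m<k  = trans (cong (_* (- ι m + ι k)) (rising-negative m k m<k)) (*-zeroˡ (- ι m + ι k))
... | inj₂ refl = trans (cong (rising (- ι m) m *_) (+-inverseˡ (ι m))) (*-zeroʳ (rising (- ι m) m))

-- The summand as a hypergeometric term in k and in P

¼ : ℚ
¼ = + 1 / 4

a⁻ a⁺ b⁺ b⁻ : ℚ → ℚ
a⁻ P = ½ - P * ½
a⁺ P = ½ + P * ½
b⁺ P = 1ℚ + P * ¼
b⁻ P = 1ℚ - P * ¼

numer denom : ℚ → ℕ → ℚ
numer P k = rising ½ k * rising (a⁻ P) k * rising (a⁺ P) k
denom P k = rising 1ℚ k * rising (b⁺ P) k * rising (b⁻ P) k

summand : ℚ → ℕ → ℚ
summand P k = ι (6 ℕ.* k ℕ.+ 1) * (numer P k ÷₀ denom P k) * pow ¼ k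

α β : ℚ → ℚ → ℚ
α P K = (½ + K) * (a⁻ P + K) * (a⁺ P + K)
β P K = (1ℚ + K) * (b⁺ P + K) * (b⁻ P + K)

private
  interchange : ∀ a b c x y z → a * x * (b * y) * (c * z) ≡ a * b * c * (x * y * z)
  interchange = solve-∀ ℚ-ring

numer-suc : ∀ P k → numer P (suc k) ≡ numer P k * α P (ι k)
numer-suc P k = interchange (rising ½ k) (rising (a⁻ P) k) (rising (a⁺ P) k) _ _ _

denom-suc : ∀ P k → denom P (suc k) ≡ denom P k * β P (ι k)
denom-suc P k = interchange (rising 1ℚ k) (rising (b⁺ P) k) (rising (b⁻ P) k) _ _ _

summand-suc : ∀ P k → denom P k ≢ 0ℚ → β P (ι k) ≢ 0ℚ →
  summand P (suc k) * (ι 4 * (ι 6 * ι k + 1ℚ) * β P (ι k)) ≡ summand P k * ((ι 6 * ι k + ι 7) * α P (ι k))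
summand-suc P k y≢0 β≢0 = begin
  ι (6 ℕ.* suc k ℕ.+ 1) * Q′ * (w * ¼) * (ι 4 * (ι 6 * K + 1ℚ) * β P K)
    ≡⟨ cong (λ c → c * Q′ * (w * ¼) * (ι 4 * (ι 6 * K + 1ℚ) * β P K)) next-coefficient ⟩
  (ι 6 * K + ι 7) * Q′ * (w * ¼) * (ι 4 * (ι 6 * K + 1ℚ) * β P K)
    ≡⟨ regroup (ι 6 * K + ι 7) (ι 6 * K + 1ℚ) Q′ w (β P K) ⟩
  (ι 6 * K + ι 7) * (ι 6 * K + 1ℚ) * w * (Q′ * (1ℚ * β P K))
    ≡⟨ cong ((ι 6 * K + ι 7) * (ι 6 * K + 1ℚ) * w *_) ratio ⟨
  (ι 6 * K + ι 7) * (ι 6 * K + 1ℚ) * w * (Q * (α P K * 1ℚ))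
    ≡⟨ regroup′ (ι 6 * K + ι 7) (ι 6 * K + 1ℚ) Q w (α P K) ⟩
  (ι 6 * K + 1ℚ) * Q * w * ((ι 6 * K + ι 7) * α P K)
    ≡⟨ cong (λ c → c * Q * w * ((ι 6 * K + ι 7) * α P K)) (ι-linear 6 k 1) ⟨
  ι (6 ℕ.* k ℕ.+ 1) * Q * w * ((ι 6 * K + ι 7) * α P K) ∎
  where
  open ≡-Reasoning
  K = ι k
  w = pow ¼ k
  Q = numer P k ÷₀ denom P k
  Q′ = numer P (suc k) ÷₀ denom P (suc k)
  ratio : Q * (α P K * 1ℚ) ≡ Q′ * (1ℚ * β P K)
  ratio = ÷₀-cross (α P K) 1ℚ 1ℚ (β P K) y≢0
    (subst (_≢ 0ℚ) (sym (denom-suc P k)) (*-≢0 y≢0 β≢0))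
    (trans (sym (numer-suc P k)) (sym (*-identityʳ _)))
    (trans (*-identityʳ _) (denom-suc P k))
  next-coefficient : ι (6 ℕ.* suc k ℕ.+ 1) ≡ ι 6 * K + ι 7
  next-coefficient = trans (ι-linear 6 (suc k) 1) (trans (cong (λ t → ι 6 * t + 1ℚ) (ι-suc k)) (affine K))
    where
    affine : ∀ K → ι 6 * (K + 1ℚ) + 1ℚ ≡ ι 6 * K + ι 7
    affine = solve-∀ ℚ-ring
  regroup : ∀ c c₀ q w b → c * q * (w * ¼) * (ι 4 * c₀ * b) ≡ c * c₀ * w * (q * (1ℚ * b))
  regroup = solve-∀ ℚ-ring
  regroup′ : ∀ c c₀ q w a → c * c₀ * w * (q * (a * 1ℚ)) ≡ c₀ * q * w * (c * a)
  regroup′ = solve-∀ ℚ-ring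

-- Both carry the factor a⁺ P (a⁺ P + 1) = a⁻ (P + 4) (a⁻ (P + 4) + 1), which spares a division.
shift-num shift-den : ℚ → ℚ → ℚ
shift-num P K = (a⁻ (P + ι 4) + K) * (a⁻ (P + ι 4) + 1ℚ + K) * (a⁺ P * (a⁺ P + 1ℚ))
                * ((b⁺ P + K) * b⁻ (P + ι 4))
shift-den P K = a⁻ (P + ι 4) * (a⁻ (P + ι 4) + 1ℚ) * ((a⁺ P + K) * (a⁺ P + 1ℚ + K))
                * (b⁺ P * (b⁻ (P + ι 4) + K))

private
  regroup-pairs : ∀ h a b s t → h * a * b * (s * t) ≡ h * (a * s) * (b * t)
  regroup-pairs = solve-∀ ℚ-ring

numer-shift : ∀ P k →
  numer P k * (a⁻ (P + ι 4) * (a⁻ (P + ι 4) + 1ℚ) * ((a⁺ P + ι k) * (a⁺ P + 1ℚ + ι k)))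
  ≡ numer (P + ι 4) k * ((a⁻ (P + ι 4) + ι k) * (a⁻ (P + ι 4) + 1ℚ + ι k) * (a⁺ P * (a⁺ P + 1ℚ)))
numer-shift P k = begin
  rising ½ k * rising (a⁻ P) k * rising (a⁺ P) k * (a⁻ P′ * (a⁻ P′ + 1ℚ) * ((a⁺ P + K) * (a⁺ P + 1ℚ + K)))
    ≡⟨ regroup-pairs (rising ½ k) _ _ _ _ ⟩
  rising ½ k * (rising (a⁻ P) k * (a⁻ P′ * (a⁻ P′ + 1ℚ))) * (rising (a⁺ P) k * ((a⁺ P + K) * (a⁺ P + 1ℚ + K)))
    ≡⟨ cong₂ (λ s t → rising ½ k * s * t) lower-a⁻ (sym raise-a⁺) ⟩
  rising ½ k * (rising (a⁻ P′) k * ((a⁻ P′ + K) * (a⁻ P′ + 1ℚ + K))) * (rising (a⁺ P′) k * (a⁺ P * (a⁺ P + 1ℚ)))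
    ≡⟨ regroup-pairs (rising ½ k) _ _ _ _ ⟨
  rising ½ k * rising (a⁻ P′) k * rising (a⁺ P′) k * ((a⁻ P′ + K) * (a⁻ P′ + 1ℚ + K) * (a⁺ P * (a⁺ P + 1ℚ))) ∎
  where
  open ≡-Reasoning
  K = ι k
  P′ = P + ι 4
  lower-a⁻ : rising (a⁻ P) k * (a⁻ P′ * (a⁻ P′ + 1ℚ)) ≡ rising (a⁻ P′) k * ((a⁻ P′ + K) * (a⁻ P′ + 1ℚ + K))
  lower-a⁻ = trans (cong (λ x → rising x k * (a⁻ P′ * (a⁻ P′ + 1ℚ))) (sym (shift P))) (rising-shift₂ (a⁻ P′) k)
    where
    shift : ∀ P → ½ - (P + ι 4) * ½ + ι 2 ≡ ½ - P * ½
    shift = solve-∀ ℚ-ring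
  raise-a⁺ : rising (a⁺ P′) k * (a⁺ P * (a⁺ P + 1ℚ)) ≡ rising (a⁺ P) k * ((a⁺ P + K) * (a⁺ P + 1ℚ + K))
  raise-a⁺ = trans (cong (λ x → rising x k * (a⁺ P * (a⁺ P + 1ℚ))) (sym (shift P))) (rising-shift₂ (a⁺ P) k)
    where
    shift : ∀ P → ½ + P * ½ + ι 2 ≡ ½ + (P + ι 4) * ½
    shift = solve-∀ ℚ-ring

denom-shift : ∀ P k →
  denom (P + ι 4) k * (b⁺ P * (b⁻ (P + ι 4) + ι k)) ≡ denom P k * ((b⁺ P + ι k) * b⁻ (P + ι 4))
denom-shift P k = begin
  rising 1ℚ k * rising (b⁺ P′) k * rising (b⁻ P′) k * (b⁺ P * (b⁻ P′ + K))
    ≡⟨ regroup-pairs (rising 1ℚ k) _ _ _ _ ⟩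
  rising 1ℚ k * (rising (b⁺ P′) k * b⁺ P) * (rising (b⁻ P′) k * (b⁻ P′ + K))
    ≡⟨ cong₂ (λ s t → rising 1ℚ k * s * t) raise-b⁺ (sym lower-b⁻) ⟩
  rising 1ℚ k * (rising (b⁺ P) k * (b⁺ P + K)) * (rising (b⁻ P) k * b⁻ P′)
    ≡⟨ regroup-pairs (rising 1ℚ k) _ _ _ _ ⟨
  rising 1ℚ k * rising (b⁺ P) k * rising (b⁻ P) k * ((b⁺ P + K) * b⁻ P′) ∎
  where
  open ≡-Reasoning
  K = ι k
  P′ = P + ι 4
  raise-b⁺ : rising (b⁺ P′) k * b⁺ P ≡ rising (b⁺ P) k * (b⁺ P + K)
  raise-b⁺ = trans (cong (λ x → rising x k * b⁺ P) (sym (shift P))) (rising-shift (b⁺ P) k)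
    where
    shift : ∀ P → 1ℚ + P * ¼ + 1ℚ ≡ 1ℚ + (P + ι 4) * ¼
    shift = solve-∀ ℚ-ring
  lower-b⁻ : rising (b⁻ P) k * b⁻ P′ ≡ rising (b⁻ P′) k * (b⁻ P′ + K)
  lower-b⁻ = trans (cong (λ x → rising x k * b⁻ P′) (sym (shift P))) (rising-shift (b⁻ P′) k)
    where
    shift : ∀ P → 1ℚ - (P + ι 4) * ¼ + 1ℚ ≡ 1ℚ - P * ¼
    shift = solve-∀ ℚ-ring

summand-shift : ∀ P k → denom P k ≢ 0ℚ → denom (P + ι 4) k ≢ 0ℚ →
  summand P k * shift-den P (ι k) ≡ summand (P + ι 4) k * shift-num P (ι k)
summand-shift P k y≢0 y′≢0 = begin
  c * Q * w * shift-den P (ι k)     ≡⟨ regroup c Q w _ ⟩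
  c * w * (Q * shift-den P (ι k))   ≡⟨ cong (c * w *_) ratio ⟩
  c * w * (Q′ * shift-num P (ι k))  ≡⟨ regroup c Q′ w _ ⟨
  c * Q′ * w * shift-num P (ι k)    ∎
  where
  open ≡-Reasoning
  c = ι (6 ℕ.* k ℕ.+ 1)
  w = pow ¼ k
  Q = numer P k ÷₀ denom P k
  Q′ = numer (P + ι 4) k ÷₀ denom (P + ι 4) k
  ratio : Q * shift-den P (ι k) ≡ Q′ * shift-num P (ι k)
  ratio = ÷₀-cross _ _ _ _ y≢0 y′≢0 (numer-shift P k) (denom-shift P k)
  regroup : ∀ c q w f → c * q * w * f ≡ c * w * (q * f)
  regroup = solve-∀ ℚ-ring

cert-num cert-den : ℚ → ℚ → ℚ
cert-num P K = - ι 8 * K * (ι 2 * K - 1ℚ) * P * (ι 4 * K + P + ι 4)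
cert-den P K = (ι 2 * K + P + 1ℚ) * (ι 2 * K + P + ι 3) * (ι 6 * K + 1ℚ)

certificate-identity : ∀ P K →
  (P * shift-den P K - (P + ι 4) * shift-num P K) * (ι 4 * (ι 6 * K + 1ℚ) * β (P + ι 4) K)
    * cert-den P K * cert-den P (K + 1ℚ)
  ≡ (ι 6 * K + ι 7) * α (P + ι 4) K * cert-num P (K + 1ℚ) * shift-den P K * cert-den P K
    - cert-num P K * shift-den P K * (ι 4 * (ι 6 * K + 1ℚ) * β (P + ι 4) K) * cert-den P (K + 1ℚ)
certificate-identity = unfolded
  where
  -- The ring solver does not unfold definitions, so the identity is restated with them inlined.
  unfolded : ∀ P K →
    let a⁻ = λ P → ½ - P * ½
        a⁺ = λ P → ½ + P * ½
        b⁺ = λ P → 1ℚ + P * ¼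
        b⁻ = λ P → 1ℚ - P * ¼
        α = λ P K → (½ + K) * (a⁻ P + K) * (a⁺ P + K)
        β = λ P K → (1ℚ + K) * (b⁺ P + K) * (b⁻ P + K)
        shift-num = (a⁻ (P + ι 4) + K) * (a⁻ (P + ι 4) + 1ℚ + K) * (a⁺ P * (a⁺ P + 1ℚ))
                    * ((b⁺ P + K) * b⁻ (P + ι 4))
        shift-den = a⁻ (P + ι 4) * (a⁻ (P + ι 4) + 1ℚ) * ((a⁺ P + K) * (a⁺ P + 1ℚ + K))
                    * (b⁺ P * (b⁻ (P + ι 4) + K))
        cert-num = λ K → - ι 8 * K * (ι 2 * K - 1ℚ) * P * (ι 4 * K + P + ι 4)
        cert-den = λ K → (ι 2 * K + P + 1ℚ) * (ι 2 * K + P + ι 3) * (ι 6 * K + 1ℚ)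
    in (P * shift-den - (P + ι 4) * shift-num) * (ι 4 * (ι 6 * K + 1ℚ) * β (P + ι 4) K)
         * cert-den K * cert-den (K + 1ℚ)
       ≡ (ι 6 * K + ι 7) * α (P + ι 4) K * cert-num (K + 1ℚ) * shift-den * cert-den K
         - cert-num K * shift-den * (ι 4 * (ι 6 * K + 1ℚ) * β (P + ι 4) K) * cert-den (K + 1ℚ)
  unfolded = solve-∀ ℚ-ring

-- Nonvanishing of the denominators for odd P

odd : ℕ → ℚ
odd n = ι (suc (2 ℕ.* n))

odd-expand : ∀ n → odd n ≡ ι 2 * ι n + 1ℚ
odd-expand n = trans (ι-suc (2 ℕ.* n)) (cong (_+ 1ℚ) (ι-* 2 n))

odd-+4 : ∀ n → odd n + ι 4 ≡ odd (suc (suc n))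
odd-+4 n = trans (sym (ι-+ (suc (2 ℕ.* n)) 4)) (cong ι (shift n))
  where
  shift : ∀ n → suc (2 ℕ.* n) ℕ.+ 4 ≡ suc (2 ℕ.* suc (suc n))
  shift = ℕ-Solver.solve-∀

≢0-of-* : ∀ s {x y} → s * x ≡ y → y ≢ 0ℚ → x ≢ 0ℚ
≢0-of-* s sx≡y y≢0 x≡0 = y≢0 (trans (sym sx≡y) (trans (cong (s *_) x≡0) (*-zeroʳ s)))

1+ι≢0 : ∀ j → 1ℚ + ι j ≢ 0ℚ
1+ι≢0 j = subst (_≢ 0ℚ) (ι-+ 1 j) (ι-suc≢0 j)

6ι+1≢0 : ∀ j → ι 6 * ι j + 1ℚ ≢ 0ℚ
6ι+1≢0 j = subst (_≢ 0ℚ) value (ι-suc≢0 (6 ℕ.* j))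
  where
  value : ι (1 ℕ.+ 6 ℕ.* j) ≡ ι 6 * ι j + 1ℚ
  value = trans (ι-+ 1 (6 ℕ.* j)) (trans (cong (λ t → 1ℚ + t) (ι-* 6 j)) (+-comm 1ℚ (ι 6 * ι j)))

a⁺-≢0 : ∀ n j → a⁺ (odd n) + ι j ≢ 0ℚ
a⁺-≢0 n j = subst (_≢ 0ℚ) (sym value) (ι-suc≢0 (n ℕ.+ j))
  where
  shape : ∀ N J → ½ + (ι 2 * N + 1ℚ) * ½ + J ≡ N + J + 1ℚ
  shape = solve-∀ ℚ-ring
  value : a⁺ (odd n) + ι j ≡ ι (suc (n ℕ.+ j))
  value = begin
    a⁺ (odd n) + ι j              ≡⟨ cong (λ P → a⁺ P + ι j) (odd-expand n) ⟩
    a⁺ (ι 2 * ι n + 1ℚ) + ι j     ≡⟨ shape (ι n) (ι j) ⟩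
    ι n + ι j + 1ℚ                ≡⟨ cong (_+ 1ℚ) (ι-+ n j) ⟨
    ι (n ℕ.+ j) + 1ℚ              ≡⟨ ι-suc (n ℕ.+ j) ⟨
    ι (suc (n ℕ.+ j))             ∎
    where open ≡-Reasoning

b⁺-≢0 : ∀ n j → b⁺ (odd n) + ι j ≢ 0ℚ
b⁺-≢0 n j = ≢0-of-* (ι 4) value (ι-suc≢0 (4 ℕ.+ 2 ℕ.* n ℕ.+ 4 ℕ.* j))
  where
  shape : ∀ N J → ι 4 * (1ℚ + (ι 2 * N + 1ℚ) * ¼ + J) ≡ ι 5 + ι 2 * N + ι 4 * J
  shape = solve-∀ ℚ-ring
  value : ι 4 * (b⁺ (odd n) + ι j) ≡ ι (5 ℕ.+ 2 ℕ.* n ℕ.+ 4 ℕ.* j)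
  value = begin
    ι 4 * (b⁺ (odd n) + ι j)               ≡⟨ cong (λ P → ι 4 * (b⁺ P + ι j)) (odd-expand n) ⟩
    ι 4 * (b⁺ (ι 2 * ι n + 1ℚ) + ι j)      ≡⟨ shape (ι n) (ι j) ⟩
    ι 5 + ι 2 * ι n + ι 4 * ι j            ≡⟨ cong₂ _+_ (trans (ι-+ 5 (2 ℕ.* n)) (cong (λ t → ι 5 + t) (ι-* 2 n)))
                                                        (ι-* 4 j) ⟨
    ι (5 ℕ.+ 2 ℕ.* n) + ι (4 ℕ.* j)        ≡⟨ ι-+ (5 ℕ.+ 2 ℕ.* n) (4 ℕ.* j) ⟨
    ι (5 ℕ.+ 2 ℕ.* n ℕ.+ 4 ℕ.* j)          ∎
    where open ≡-Reasoning

quarter-odd≢ι : ∀ n j → ι j - odd n * ¼ ≢ 0ℚ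
quarter-odd≢ι n j difference≡0 = ℕ.even≢odd (2 ℕ.* j) n (trans (sym (ℕ.*-assoc 2 2 j)) (ι-injective value))
  where
  shape : ∀ J P → ι 4 * J ≡ ι 4 * (J - P * ¼) + P
  shape = solve-∀ ℚ-ring
  value : ι (4 ℕ.* j) ≡ odd n
  value = begin
    ι (4 ℕ.* j)                         ≡⟨ ι-* 4 j ⟩
    ι 4 * ι j                           ≡⟨ shape (ι j) (odd n) ⟩
    ι 4 * (ι j - odd n * ¼) + odd n     ≡⟨ cong (λ t → ι 4 * t + odd n) difference≡0 ⟩
    ι 4 * 0ℚ + odd n                    ≡⟨ cong (_+ odd n) (*-zeroʳ (ι 4)) ⟩
    0ℚ + odd n                          ≡⟨ +-identityˡ (odd n) ⟩
    odd n                               ∎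
    where open ≡-Reasoning

b⁻-≢0 : ∀ n j → b⁻ (odd n) + ι j ≢ 0ℚ
b⁻-≢0 n j = subst (_≢ 0ℚ) (sym value) (quarter-odd≢ι n (suc j))
  where
  shape : ∀ P J → 1ℚ - P * ¼ + J ≡ J + 1ℚ - P * ¼
  shape = solve-∀ ℚ-ring
  value : b⁻ (odd n) + ι j ≡ ι (suc j) - odd n * ¼
  value = trans (shape (odd n) (ι j)) (cong (λ t → t - odd n * ¼) (sym (ι-suc j)))

β-≢0 : ∀ n j → β (odd n) (ι j) ≢ 0ℚ
β-≢0 n j = *-≢0 (*-≢0 (1+ι≢0 j) (b⁺-≢0 n j)) (b⁻-≢0 n j)

denom-≢0 : ∀ n k → denom (odd n) k ≢ 0ℚ
denom-≢0 n zero    = λ ()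
denom-≢0 n (suc k) = subst (_≢ 0ℚ) (sym (denom-suc (odd n) k)) (*-≢0 (denom-≢0 n k) (β-≢0 n k))

shift-den-≢0 : ∀ n j → shift-den (odd n) (ι j) ≢ 0ℚ
shift-den-≢0 n j = *-≢0 (*-≢0 (*-≢0 first second) (*-≢0 (a⁺-≢0 n j) fourth)) (*-≢0 fifth sixth)
  where
  P = odd n
  first : a⁻ (P + ι 4) ≢ 0ℚ
  first = ≢0-of-* (- 1ℚ) (shape P) (a⁺-≢0 n 1)
    where
    shape : ∀ P → - 1ℚ * (½ - (P + ι 4) * ½) ≡ ½ + P * ½ + ι 1
    shape = solve-∀ ℚ-ring
  second : a⁻ (P + ι 4) + 1ℚ ≢ 0ℚ
  second = ≢0-of-* (- 1ℚ) (shape P) (a⁺-≢0 n 0)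
    where
    shape : ∀ P → - 1ℚ * (½ - (P + ι 4) * ½ + 1ℚ) ≡ ½ + P * ½ + ι 0
    shape = solve-∀ ℚ-ring
  fourth : a⁺ P + 1ℚ + ι j ≢ 0ℚ
  fourth = subst (_≢ 0ℚ) (trans (cong (λ t → a⁺ P + t) (ι-suc j)) (shape (a⁺ P) (ι j))) (a⁺-≢0 n (suc j))
    where
    shape : ∀ A J → A + (J + 1ℚ) ≡ A + 1ℚ + J
    shape = solve-∀ ℚ-ring
  fifth : b⁺ P ≢ 0ℚ
  fifth = subst (_≢ 0ℚ) (+-identityʳ (b⁺ P)) (b⁺-≢0 n 0)
  sixth : b⁻ (P + ι 4) + ι j ≢ 0ℚ
  sixth = subst (_≢ 0ℚ) (sym (shape P (ι j))) (quarter-odd≢ι n j)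
    where
    shape : ∀ P J → 1ℚ - (P + ι 4) * ¼ + J ≡ J - P * ¼
    shape = solve-∀ ℚ-ring

cert-den-≢0 : ∀ n j → cert-den (odd n) (ι j) ≢ 0ℚ
cert-den-≢0 n j = *-≢0 (*-≢0 first second) (6ι+1≢0 j)
  where
  P = odd n
  first : ι 2 * ι j + P + 1ℚ ≢ 0ℚ
  first = ≢0-of-* ½ (shape P (ι j)) (a⁺-≢0 n j)
    where
    shape : ∀ P J → ½ * (ι 2 * J + P + 1ℚ) ≡ ½ + P * ½ + J
    shape = solve-∀ ℚ-ring
  second : ι 2 * ι j + P + ι 3 ≢ 0ℚ
  second = ≢0-of-* ½ (trans (shape P (ι j)) (cong (λ t → a⁺ P + t) (sym (ι-suc j)))) (a⁺-≢0 n (suc j))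
    where
    shape : ∀ P J → ½ * (ι 2 * J + P + ι 3) ≡ ½ + P * ½ + (J + 1ℚ)
    shape = solve-∀ ℚ-ring

-- The recurrence and the closed form

summand-vanishes : ∀ n k → n < k → summand (odd n) k ≡ 0ℚ
summand-vanishes n k n<k = begin
  ι (6 ℕ.* k ℕ.+ 1) * (numer (odd n) k ÷₀ denom (odd n) k) * pow ¼ k
    ≡⟨ cong (λ x → ι (6 ℕ.* k ℕ.+ 1) * (x ÷₀ denom (odd n) k) * pow ¼ k) numer≡0 ⟩
  ι (6 ℕ.* k ℕ.+ 1) * (0ℚ ÷₀ denom (odd n) k) * pow ¼ k
    ≡⟨ cong (λ x → ι (6 ℕ.* k ℕ.+ 1) * x * pow ¼ k) (0÷₀ (denom (odd n) k)) ⟩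
  ι (6 ℕ.* k ℕ.+ 1) * 0ℚ * pow ¼ k
    ≡⟨ cong (_* pow ¼ k) (*-zeroʳ (ι (6 ℕ.* k ℕ.+ 1))) ⟩
  0ℚ * pow ¼ k
    ≡⟨ *-zeroˡ (pow ¼ k) ⟩
  0ℚ ∎
  where
  open ≡-Reasoning
  a⁻-odd : ∀ N → ½ - (ι 2 * N + 1ℚ) * ½ ≡ - N
  a⁻-odd = solve-∀ ℚ-ring
  numer≡0 : numer (odd n) k ≡ 0ℚ
  numer≡0 = begin
    rising ½ k * rising (a⁻ (odd n)) k * rising (a⁺ (odd n)) k
      ≡⟨ cong (λ x → rising ½ k * rising x k * rising (a⁺ (odd n)) k)
              (trans (cong a⁻ (odd-expand n)) (a⁻-odd (ι n))) ⟩
    rising ½ k * rising (- ι n) k * rising (a⁺ (odd n)) k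
      ≡⟨ cong (λ x → rising ½ k * x * rising (a⁺ (odd n)) k) (rising-negative n k n<k) ⟩
    rising ½ k * 0ℚ * rising (a⁺ (odd n)) k
      ≡⟨ cong (_* rising (a⁺ (odd n)) k) (*-zeroʳ (rising ½ k)) ⟩
    0ℚ * rising (a⁺ (odd n)) k
      ≡⟨ *-zeroˡ (rising (a⁺ (odd n)) k) ⟩
    0ℚ ∎

module Recurrence (n : ℕ) where

  P P′ : ℚ
  P  = odd n
  P′ = P + ι 4

  R : ℚ → ℚ
  R K = cert-num P K ÷₀ cert-den P K

  u v G : ℕ → ℚ
  u = summand P′
  v = summand P
  G k = u k * R (ι k)

  denom′-≢0 : ∀ k → denom P′ k ≢ 0ℚ
  denom′-≢0 k = subst (λ P → denom P k ≢ 0ℚ) (sym (odd-+4 n)) (denom-≢0 (suc (suc n)) k)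

  β′-≢0 : ∀ k → β P′ (ι k) ≢ 0ℚ
  β′-≢0 k = subst (λ P → β P (ι k) ≢ 0ℚ) (sym (odd-+4 n)) (β-≢0 (suc (suc n)) k)

  telescopes : ∀ k → P * u k - P′ * v k ≡ G (suc k) - G k
  telescopes k =
    trans step (cong (λ t → u (suc k) * R t - G k) (sym (ι-suc k)))
    where
    K = ι k
    D≢0 : ι 4 * (ι 6 * K + 1ℚ) * β P′ K ≢ 0ℚ
    D≢0 = *-≢0 (*-≢0 (ι-suc≢0 3) (6ι+1≢0 k)) (β′-≢0 k)
    q₁≢0 : cert-den P (K + 1ℚ) ≢ 0ℚ
    q₁≢0 = subst (λ t → cert-den P t ≢ 0ℚ) (ι-suc k) (cert-den-≢0 n (suc k))
    step : P * u k - P′ * v k ≡ u (suc k) * R (K + 1ℚ) - u k * R K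
    step = telescoping-from-ratios
             {a = P} {b = P′} {u = u k} {u′ = u (suc k)} {v = v k} {E = (ι 6 * K + ι 7) * α P′ K}
             {E′ = shift-num P K} {r₀ = cert-num P K} {r₁ = cert-num P (K + 1ℚ)}
             D≢0 (shift-den-≢0 n k) (cert-den-≢0 n k) q₁≢0
             (summand-suc P′ k (denom′-≢0 k) (β′-≢0 k))
             (summand-shift P k (denom-≢0 n k) (denom′-≢0 k))
             (certificate-identity P K)

  recurrence : P * sumTo (suc (suc n)) u ≡ P′ * sumTo n v
  recurrence = p-q≡0⇒p≡q (begin
    P * sumTo (suc (suc n)) u - P′ * sumTo n v
      ≡⟨ cong (λ t → P * sumTo (suc (suc n)) u - P′ * t) (sym tail-vanishes) ⟩
    P * sumTo (suc (suc n)) u - P′ * sumTo (suc (suc n)) v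
      ≡⟨ sumTo-linear P P′ u v (suc (suc n)) ⟨
    sumTo (suc (suc n)) (λ k → P * u k - P′ * v k)
      ≡⟨ sumTo-telescope _ G (suc (suc n)) telescopes ⟩
    G (3 ℕ.+ n) - G 0
      ≡⟨ cong₂ _-_ G-end G-start ⟩
    0ℚ - 0ℚ
      ≡⟨⟩
    0ℚ ∎)
    where
    open ≡-Reasoning
    tail-vanishes : sumTo (suc (suc n)) v ≡ sumTo n v
    tail-vanishes = begin
      sumTo n v + v (1 ℕ.+ n) + v (2 ℕ.+ n)
        ≡⟨ cong₂ (λ s t → sumTo n v + s + t) (summand-vanishes n (1 ℕ.+ n) (ℕ.n<1+n n))
                                             (summand-vanishes n (2 ℕ.+ n) (ℕ.m<n+m n (ℕ.s≤s ℕ.z≤n))) ⟩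
      sumTo n v + 0ℚ + 0ℚ
        ≡⟨ trans (+-identityʳ _) (+-identityʳ _) ⟩
      sumTo n v ∎
    G-end : G (3 ℕ.+ n) ≡ 0ℚ
    G-end = trans (cong (_* R (ι (3 ℕ.+ n))) u-end) (*-zeroˡ (R (ι (3 ℕ.+ n))))
      where
      u-end : u (3 ℕ.+ n) ≡ 0ℚ
      u-end = subst (λ P → summand P (3 ℕ.+ n) ≡ 0ℚ) (sym (odd-+4 n))
                    (summand-vanishes (2 ℕ.+ n) (3 ℕ.+ n) (ℕ.n<1+n (2 ℕ.+ n)))
    G-start : G 0 ≡ 0ℚ
    G-start = trans (cong (λ t → u 0 * (t ÷₀ cert-den P 0ℚ)) (cert-num-at-0 P))
                    (trans (cong (u 0 *_) (0÷₀ (cert-den P 0ℚ))) (*-zeroʳ (u 0)))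
      where
      cert-num-at-0 : ∀ P → - ι 8 * 0ℚ * (ι 2 * 0ℚ - 1ℚ) * P * (ι 4 * 0ℚ + P + ι 4) ≡ 0ℚ
      cert-num-at-0 = solve-∀ ℚ-ring

closed-form : ∀ n → sumTo n (summand (odd n)) ≡ pow (- 1ℚ) n * odd n
closed-form zero          = refl
closed-form (suc zero)    = refl
closed-form (suc (suc n)) = *-cancelˡ-≢0 _ _ (ι-suc≢0 (2 ℕ.* n)) (begin
  odd n * sumTo (2 ℕ.+ n) (summand (odd (2 ℕ.+ n)))
    ≡⟨ cong (λ P → odd n * sumTo (2 ℕ.+ n) (summand P)) (odd-+4 n) ⟨
  odd n * sumTo (2 ℕ.+ n) (summand (odd n + ι 4))
    ≡⟨ Recurrence.recurrence n ⟩
  (odd n + ι 4) * sumTo n (summand (odd n))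
    ≡⟨ cong ((odd n + ι 4) *_) (closed-form n) ⟩
  (odd n + ι 4) * (pow (- 1ℚ) n * odd n)
    ≡⟨ square-sign (odd n) (ι 4) (pow (- 1ℚ) n) ⟩
  odd n * (pow (- 1ℚ) n * - 1ℚ * - 1ℚ * (odd n + ι 4))
    ≡⟨ cong (λ P → odd n * (pow (- 1ℚ) (2 ℕ.+ n) * P)) (odd-+4 n) ⟩
  odd n * (pow (- 1ℚ) (2 ℕ.+ n) * odd (2 ℕ.+ n)) ∎)
  where
  open ≡-Reasoning
  square-sign : ∀ P c s → (P + c) * (s * P) ≡ P * (s * - 1ℚ * - 1ℚ * (P + c))
  square-sign = solve-∀ ℚ-ring

odd-witness : ∀ {p} → ¬ 2 ∣ p → ∃ λ n → p ≡ suc (2 ℕ.* n)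
odd-witness {zero}        ¬2∣p = ⊥-elim (¬2∣p (divides 0 refl))
odd-witness {suc zero}    _    = 0 , refl
odd-witness {suc (suc p)} ¬2∣p with odd-witness {p} (λ 2∣p → ¬2∣p (∣m∣n⇒∣m+n ∣-refl 2∣p))
... | n , refl = suc n , cong suc (cong suc (sym (ℕ.+-suc n (n ℕ.+ 0))))

half-index : ∀ n → (suc (2 ℕ.* n) ∸ 1) ℕ./ 2 ≡ n
half-index n = trans (cong (ℕ._/ 2) (ℕ.*-comm 2 n)) (m*n/n≡m n 2)

mainTheorem10 : (p : ℕ) → Prime p → ¬ (2 ∣ p) →
    sumTo ((p ∸ 1) ℕ./ 2)
      (λ k → ((+ (6 ℕ.* k ℕ.+ 1)) / 1)
        * ((rising (+ 1 / 2) k * rising (+ 1 / 2 - + p / 2) k * rising (+ 1 / 2 + + p / 2) k)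
           ÷₀ (rising (+ 1 / 1) k * rising (+ 1 / 1 + + p / 4) k * rising (+ 1 / 1 - + p / 4) k))
        * pow (+ 1 / 4) k)
    ≡ pow (-[1+ 0 ] / 1) ((p ∸ 1) ℕ./ 2) * (+ p / 1)
mainTheorem10 p _ p-odd with odd-witness p-odd
-- Once p/2 and p/4 are rewritten as ι p * ½ and ι p * ¼, the summand is summand (ι p) by definition.
... | n , refl rewrite /-ι (suc (2 ℕ.* n)) 1 | /-ι (suc (2 ℕ.* n)) 3 | half-index n = closed-form n
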